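{- Let $\mathcal R\subset\mathbb{Z}^k$ be a polyhedral region. Then either for every positive integer $n$ the region $\mathcal R$ contains a $k$-dimensional box of size $n$, or $\mathcal R$ is a set of measure zero.
   Context: A hyperplane in $\mathbb{Z}^k$ is $\{\mathbf z:\mathbf v\cdot\mathbf z=n\}$ and a half-space is $\{\mathbf z:\mathbf v\cdot\mathbf z>n\}$, with $\mathbf v\in\mathbb{Z}^k$, $n\in\mathbb{Z}$. A region is polyhedral if it equals $\mathbb{Z}^k$ or is the intersection of finitely many half-spaces. A set of measure zero is a subset of $\mathbb{Z}^k$ covered by finitely many hyperplanes. A $k$-dimensional box of size $n$ is a set $\{\mathbf z\in\mathbb{Z}^k: c_i\le z_i\le c_i+n,\ i=1,\ldots,k\}$ with $c_i\in\mathbb{Z}$. -}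

module Defs where

open import Data.Nat using (ℕ; zero; suc)
open import Data.Integer using (ℤ; +_; _+_; _*_; _<_; _≤_; 0ℤ)
open import Data.Fin using (Fin)
open import Data.Product using (Σ; ∃; _×_; _,_)
open import Data.List using (List)
open import Data.List.Relation.Unary.All using (All)
open import Data.List.Relation.Unary.Any using (Any)
open import Relation.Binary.PropositionalEquality using (_≡_)
open import Relation.Nullary using (¬_)
open import Function.Bundles using (_⇔_)

Point : ℕ → Set
Point k = Fin k → ℤ

dot : ∀ {k} → Point k → Point k → ℤ
dot {zero}  v z = 0ℤ
dot {suc k} v z = v Fin.zero * z Fin.zero + dot (λ i → v (Fin.suc i)) (λ i → z (Fin.suc i))
  where import Data.Fin as Fin

Region : ℕ → Set₁
Region k = Point k → Set

-- data of a half-space / hyperplane: a vector v and an integer n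
Linear : ℕ → Set
Linear k = Point k × ℤ

InHalfSpace : ∀ {k} → Linear k → Point k → Set
InHalfSpace (v , n) z = n < dot v z

InHyperplane : ∀ {k} → Linear k → Point k → Set
InHyperplane (v , n) z = dot v z ≡ n

-- v is a nonzero vector (so the hyperplane is a genuine hyperplane)
NonZeroVec : ∀ {k} → Point k → Set
NonZeroVec v = ¬ (∀ i → v i ≡ 0ℤ)

Polyhedral : ∀ {k} → Region k → Set
Polyhedral {k} R =
  (∀ z → R z)
  ⊎' Σ (List (Linear k)) (λ hs → ∀ z → R z ⇔ All (λ h → InHalfSpace h z) hs)
  where open import Data.Sum using () renaming (_⊎_ to _⊎'_)

MeasureZero : ∀ {k} → Region k → Set
MeasureZero {k} R =
  Σ (List (Linear k)) (λ hs →
    All (λ h → NonZeroVec (Data.Product.proj₁ h)) hs ×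
    (∀ z → R z → Any (λ h → InHyperplane h z) hs))
  where import Data.Product

InBox : ∀ {k} → Point k → ℕ → Point k → Set
InBox c n z = ∀ i → (c i ≤ z i) × (z i ≤ c i + + n)

ContainsBox : ∀ {k} → Region k → ℕ → Set
ContainsBox R n = ∃ λ c → ∀ z → InBox c n z → R z

-- Write R as the intersection of half-spaces v · z > n. One with zero normal is either empty,
-- and then so is R, or all of ℤ^k. For the nonzero normals, an integer form of Gordan's
-- alternative, proved by Fourier–Motzkin elimination, gives either a direction d with v · d > 0
-- for every normal v, or a nonempty combination Σ (1 + cⱼ) vⱼ = 0 of normals. In the first case
-- a box of any size with corner far enough out along d lies in every half-space. In the second,
-- each vⱼ · z is bounded below on R, so the relation bounds v₁ · z above as well, and R lies on
-- the finitely many hyperplanes v₁ · z = m with m in that range.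
module Submission where

open import Defs
open import Data.Nat as ℕ using (ℕ; zero; suc; s≤s)
import Data.Nat.Properties as ℕ
open import Data.Nat.ListAction using (sum)
open import Data.Integer as ℤ
  using (ℤ; +_; -[1+_]; +[1+_]; _+_; _*_; _-_; -_; _<_; _≤_; 0ℤ; 1ℤ; ∣_∣; +≤+; +<+)
import Data.Integer.Properties as ℤ
open import Data.Integer.DivMod using (_/ℕ_; [n/ℕd]*d≤n; n<s[n/ℕd]*d)
open import Data.Integer.Tactic.RingSolver using (solve-∀)
open import Data.Fin using () renaming (zero to fzero; suc to fsuc)
import Data.Fin.Properties as Fin
open import Data.Vec.Functional using (head; tail) renaming (_∷_ to _∷ᶠ_)
open import Data.List using (List; []; _∷_; _++_; map; concatMap; filter)
open import Data.List.Membership.Propositional using (_∈_; find; lose)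
open import Data.List.Membership.Propositional.Properties
open import Data.List.Relation.Unary.Any as Any using (Any; here; there)
open import Data.List.Relation.Unary.All as All using (All; []; _∷_)
import Data.List.Relation.Unary.All.Properties as All
import Data.List.Extrema ℤ.≤-totalOrder as Extrema
open import Data.Product using (Σ; ∃; _×_; _,_; proj₁; proj₂)
open import Data.Sum using (_⊎_; inj₁; inj₂)
open import Data.Empty using (⊥-elim)
open import Relation.Nullary using (yes; no; ¬_; Dec; ¬?)
open import Relation.Nullary.Decidable using (_×-dec_)
open import Relation.Binary.PropositionalEquality
open import Function using (_∘_; id)
open import Function.Bundles using (Equivalence)

private variable
  k m : ℕ

i≤+∣i∣ : ∀ i → i ≤ + ∣ i ∣
i≤+∣i∣ (+ n)    = ℤ.≤-refl
i≤+∣i∣ -[1+ n ] = ℤ.-≤+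

-+∣i∣≤i : ∀ i → - + ∣ i ∣ ≤ i
-+∣i∣≤i (+ n)    = ℤ.neg-≤-pos
-+∣i∣≤i -[1+ n ] = ℤ.≤-refl

0≤i≤+n⇒∣i∣≤n : ∀ {x N} → 0ℤ ≤ x → x ≤ + N → ∣ x ∣ ℕ.≤ N
0≤i≤+n⇒∣i∣≤n (+≤+ _) (+≤+ m≤N) = m≤N

[1+c]*i≤+n⇒i≤+n : ∀ c x L → + suc c * x ≤ + L → x ≤ + L
[1+c]*i≤+n⇒i≤+n c -[1+ n ] L _   = ℤ.-≤+
[1+c]*i≤+n⇒i≤+n c (+ m)    L cx≤L =
  ℤ.≤-trans (+≤+ (ℕ.m≤n*m m (suc c))) (subst (_≤ + L) (sym (ℤ.pos-* (suc c) m)) cx≤L)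

≤-sum-map : {A : Set} (f : A → ℕ) {x : A} {xs : List A} → x ∈ xs → f x ℕ.≤ sum (map f xs)
≤-sum-map f {xs = y ∷ ys} (here refl) = ℕ.m≤m+n (f y) _
≤-sum-map f {xs = y ∷ ys} (there x∈ys) = ℕ.≤-trans (≤-sum-map f x∈ys) (ℕ.m≤n+m _ (f y))

data NonEmpty {A : Set} : List A → Set where
  nonEmpty : ∀ {x xs} → NonEmpty (x ∷ xs)

NonEmpty-++ : {A : Set} {xs : List A} (ys : List A) → NonEmpty xs → NonEmpty (xs ++ ys)
NonEmpty-++ ys nonEmpty = nonEmpty

IsZero : Point k → Set
IsZero v = ∀ i → v i ≡ 0ℤ

isZero? : (v : Point k) → Dec (IsZero v)
isZero? v = Fin.all? (λ i → v i ℤ.≟ 0ℤ)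

dot-congʳ : (v : Point k) {z y : Point k} → (∀ i → z i ≡ y i) → dot v z ≡ dot v y
dot-congʳ {zero}  v eq = refl
dot-congʳ {suc k} v eq = cong₂ _+_ (cong (head v *_) (eq fzero)) (dot-congʳ (tail v) (eq ∘ fsuc))

dot-zeroˡ : (v z : Point k) → IsZero v → dot v z ≡ 0ℤ
dot-zeroˡ {zero}  v z _ = refl
dot-zeroˡ {suc k} v z v≡0 = cong₂ _+_
  (trans (cong (_* head z) (v≡0 fzero)) (ℤ.*-zeroˡ (head z)))
  (dot-zeroˡ (tail v) (tail z) (v≡0 ∘ fsuc))

dot-+ʳ : (v x y : Point k) → dot v (λ i → x i + y i) ≡ dot v x + dot v y
dot-+ʳ {zero}  v x y = refl
dot-+ʳ {suc k} v x y
  rewrite dot-+ʳ (tail v) (tail x) (tail y) = distrib (head v) (head x) (head y) _ _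
  where
  distrib : ∀ a b c p q → a * (b + c) + (p + q) ≡ (a * b + p) + (a * c + q)
  distrib = solve-∀

dot-*ʳ : (v x : Point k) (c : ℤ) → dot v (λ i → c * x i) ≡ c * dot v x
dot-*ʳ {zero}  v x c = sym (ℤ.*-zeroʳ c)
dot-*ʳ {suc k} v x c rewrite dot-*ʳ (tail v) (tail x) c = distrib (head v) (head x) c _
  where
  distrib : ∀ a b c p → a * (c * b) + c * p ≡ c * (a * b + p)
  distrib = solve-∀

dot-linearˡ : (a b : ℤ) (v w z : Point k) →
              dot (λ i → a * v i + b * w i) z ≡ a * dot v z + b * dot w z
dot-linearˡ {zero}  a b v w z = sym (cong₂ _+_ (ℤ.*-zeroʳ a) (ℤ.*-zeroʳ b))
dot-linearˡ {suc k} a b v w z rewrite dot-linearˡ a b (tail v) (tail w) (tail z) =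
  distrib a b (head v) (head w) (head z) _ _
  where
  distrib : ∀ a b p q x P Q → (a * p + b * q) * x + (a * P + b * Q) ≡ a * (p * x + P) + b * (q * x + Q)
  distrib = solve-∀

norm₁ : Point k → ℕ
norm₁ {zero}  v = 0
norm₁ {suc k} v = ∣ head v ∣ ℕ.+ norm₁ (tail v)

dot-lowerBound : ∀ N (v e : Point k) → (∀ i → ∣ e i ∣ ℕ.≤ N) → - + (norm₁ v ℕ.* N) ≤ dot v e
dot-lowerBound {zero}  N v e ∣e∣≤N = ℤ.≤-refl
dot-lowerBound {suc k} N v e ∣e∣≤N = begin
  - + (norm₁ v ℕ.* N)
    ≡⟨ cong (-_ ∘ +_) (ℕ.*-distribʳ-+ N ∣ head v ∣ (norm₁ (tail v))) ⟩
  - + (∣ head v ∣ ℕ.* N ℕ.+ norm₁ (tail v) ℕ.* N)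
    ≡⟨ trans (cong -_ (sym (ℤ.pos-+ (∣ head v ∣ ℕ.* N) (norm₁ (tail v) ℕ.* N))))
             (ℤ.neg-distrib-+ (+ (∣ head v ∣ ℕ.* N)) (+ (norm₁ (tail v) ℕ.* N))) ⟩
  - + (∣ head v ∣ ℕ.* N) + - + (norm₁ (tail v) ℕ.* N)
    ≤⟨ ℤ.+-mono-≤ head-bound (dot-lowerBound N (tail v) (tail e) (∣e∣≤N ∘ fsuc)) ⟩
  head v * head e + dot (tail v) (tail e) ∎
  where
  open ℤ.≤-Reasoning
  head-bound : - + (∣ head v ∣ ℕ.* N) ≤ head v * head e
  head-bound = ℤ.≤-trans
    (ℤ.neg-mono-≤ (+≤+ (subst (ℕ._≤ ∣ head v ∣ ℕ.* N) (sym (ℤ.∣i*j∣≡∣i∣*∣j∣ (head v) (head e)))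
                                (ℕ.*-monoʳ-≤ ∣ head v ∣ (∣e∣≤N fzero)))))
    (-+∣i∣≤i (head v * head e))

-- Positive combinations

-- A term (c , v) stands for the positive multiple (1 + c) v.
Term : ℕ → Set
Term k = ℕ × Point k

⟦_⟧ : List (Term k) → Point k → ℤ
⟦ [] ⟧          z = 0ℤ
⟦ (c , v) ∷ ts ⟧ z = + suc c * dot v z + ⟦ ts ⟧ z

⟦⟧-++ : (ts us : List (Term k)) (z : Point k) → ⟦ ts ++ us ⟧ z ≡ ⟦ ts ⟧ z + ⟦ us ⟧ z
⟦⟧-++ []             us z = sym (ℤ.+-identityˡ _)
⟦⟧-++ ((c , v) ∷ ts) us z rewrite ⟦⟧-++ ts us z = sym (ℤ.+-assoc (+ suc c * dot v z) _ _)

scale : ℕ → List (Term k) → List (Term k)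
scale c = map (λ (c′ , v) → (c′ ℕ.+ c ℕ.* suc c′ , v))

⟦⟧-scale : (c : ℕ) (ts : List (Term k)) (z : Point k) → ⟦ scale c ts ⟧ z ≡ + suc c * ⟦ ts ⟧ z
⟦⟧-scale c []              z = sym (ℤ.*-zeroʳ (+ suc c))
⟦⟧-scale c ((c′ , v) ∷ ts) z rewrite ⟦⟧-scale c ts z | ℤ.pos-* (suc c) (suc c′) =
  distrib (+ suc c) (+ suc c′) (dot v z) (⟦ ts ⟧ z)
  where
  distrib : ∀ a b x r → a * b * x + a * r ≡ a * (b * x + r)
  distrib = solve-∀

NonEmpty-scale : (c : ℕ) {ts : List (Term k)} → NonEmpty ts → NonEmpty (scale c ts)
NonEmpty-scale c nonEmpty = nonEmpty

Over : List (Point k) → List (Term k) → Set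
Over vs = All (λ t → proj₂ t ∈ vs)

Over-scale : (c : ℕ) {vs : List (Point k)} {ts : List (Term k)} → Over vs ts → Over vs (scale c ts)
Over-scale c = All.map⁺

PositiveDirection : List (Point k) → Set
PositiveDirection {k} vs = Σ (Point k) λ d → ∀ {v} → v ∈ vs → 0ℤ < dot v d

PositiveDependence : List (Point k) → Set
PositiveDependence {k} vs =
  Σ (List (Term k)) λ ts → NonEmpty ts × Over vs ts × (∀ z → ⟦ ts ⟧ z ≡ 0ℤ)

Lifts : (Point m → Point k) → List (Point m) → Point k → Set
Lifts {m} π vs w =
  Σ (List (Term m)) λ ts → NonEmpty ts × Over vs ts × (∀ z → ⟦ ts ⟧ z ≡ dot w (π z))

module _ (π : Point m → Point k) {vs : List (Point m)} {ws : List (Point k)}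
         (lifts : ∀ {w} → w ∈ ws → Lifts π vs w) where

  lift-combination : (us : List (Term k)) → Over ws us →
    Σ (List (Term m)) λ ts → (NonEmpty us → NonEmpty ts) × Over vs ts × (∀ z → ⟦ ts ⟧ z ≡ ⟦ us ⟧ (π z))
  lift-combination [] [] = [] , (λ ()) , [] , λ _ → refl
  lift-combination ((c , w) ∷ us) (w∈ws ∷ us⊆ws)
    with lifts w∈ws | lift-combination us us⊆ws
  ... | ts , ts≢[] , ts⊆vs , ⟦ts⟧ | ts′ , _ , ts′⊆vs , ⟦ts′⟧ =
    scale c ts ++ ts′ ,
    (λ _ → NonEmpty-++ ts′ (NonEmpty-scale c ts≢[])) ,
    All.++⁺ (Over-scale c ts⊆vs) ts′⊆vs ,
    λ z → begin
      ⟦ scale c ts ++ ts′ ⟧ z           ≡⟨ ⟦⟧-++ (scale c ts) ts′ z ⟩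
      ⟦ scale c ts ⟧ z + ⟦ ts′ ⟧ z      ≡⟨ cong₂ _+_ (⟦⟧-scale c ts z) (⟦ts′⟧ z) ⟩
      + suc c * ⟦ ts ⟧ z + ⟦ us ⟧ (π z) ≡⟨ cong (λ x → + suc c * x + ⟦ us ⟧ (π z)) (⟦ts⟧ z) ⟩
      ⟦ (c , w) ∷ us ⟧ (π z)            ∎
    where open ≡-Reasoning

  lift-dependence : PositiveDependence ws → PositiveDependence vs
  lift-dependence (us , us≢[] , us⊆ws , ⟦us⟧≡0) with lift-combination us us⊆ws
  ... | ts , ts≢[] , ts⊆vs , ⟦ts⟧ = ts , ts≢[] us≢[] , ts⊆vs , λ z → trans (⟦ts⟧ z) (⟦us⟧≡0 (π z))

weight : List (Term k) → ℕ
weight = sum ∘ map (suc ∘ proj₁)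

⟦⟧-lowerBound : ∀ N {vs : List (Point k)} {z} → (∀ {v} → v ∈ vs → - + N ≤ dot v z) →
                (ts : List (Term k)) → Over vs ts → - + (weight ts ℕ.* N) ≤ ⟦ ts ⟧ z
⟦⟧-lowerBound N bounded []             []             = ℤ.≤-refl
⟦⟧-lowerBound N {z = z} bounded ((c , v) ∷ ts) (v∈vs ∷ ts⊆vs) = begin
  - + (weight ((c , v) ∷ ts) ℕ.* N)
    ≡⟨ cong (-_ ∘ +_) (ℕ.*-distribʳ-+ N (suc c) (weight ts)) ⟩
  - + (suc c ℕ.* N ℕ.+ weight ts ℕ.* N)
    ≡⟨ trans (cong -_ (sym (ℤ.pos-+ (suc c ℕ.* N) (weight ts ℕ.* N))))
             (ℤ.neg-distrib-+ (+ (suc c ℕ.* N)) (+ (weight ts ℕ.* N))) ⟩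
  - + (suc c ℕ.* N) + - + (weight ts ℕ.* N)
    ≤⟨ ℤ.+-mono-≤ term-bound (⟦⟧-lowerBound N bounded ts ts⊆vs) ⟩
  + suc c * dot v z + ⟦ ts ⟧ z ∎
  where
  open ℤ.≤-Reasoning
  term-bound : - + (suc c ℕ.* N) ≤ + suc c * dot v z
  term-bound = subst (_≤ + suc c * dot v z)
    (trans (sym (ℤ.neg-distribʳ-* (+ suc c) (+ N))) (cong -_ (sym (ℤ.pos-* (suc c) N))))
    (ℤ.*-monoˡ-≤-nonNeg (+ suc c) (bounded v∈vs))

-- Gordan's alternative by Fourier–Motzkin elimination

combine : ℕ → ℕ → Point (suc k) → Point (suc k) → Point k
combine α β p q i = + suc β * tail p i + + suc α * tail q i

zeroRow : ℤ → Point k → List (Point k)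
zeroRow (+ zero) w = w ∷ []
zeroRow _        _ = []

pairRow : ℤ → ℤ → Point (suc k) → Point (suc k) → List (Point k)
pairRow +[1+ α ] -[1+ β ] p q = combine α β p q ∷ []
pairRow _        _        _ _ = []

zeroRows : Point (suc k) → List (Point k)
zeroRows v = zeroRow (head v) (tail v)

pairRows : List (Point (suc k)) → Point (suc k) → List (Point k)
pairRows vs p = concatMap (λ q → pairRow (head p) (head q) p q) vs

eliminate : List (Point (suc k)) → List (Point k)
eliminate vs = concatMap zeroRows vs ++ concatMap (pairRows vs) vs

data Eliminated (vs : List (Point (suc k))) : Point k → Set where
  zero-head      : ∀ {v} → v ∈ vs → head v ≡ 0ℤ → Eliminated vs (tail v)
  opposite-heads : ∀ {p q α β} → p ∈ vs → q ∈ vs → head p ≡ +[1+ α ] → head q ≡ -[1+ β ] →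
                   Eliminated vs (combine α β p q)

∈-eliminate⁺ : {vs : List (Point (suc k))} {w : Point k} → Eliminated vs w → w ∈ eliminate vs
∈-eliminate⁺ {vs = vs} (zero-head {v} v∈vs v₀≡0) =
  ∈-++⁺ˡ (∈-concatMap⁺ zeroRows (lose v∈vs w∈zeroRows))
  where
  w∈zeroRows : tail v ∈ zeroRows v
  w∈zeroRows rewrite v₀≡0 = here refl
∈-eliminate⁺ {vs = vs} (opposite-heads {p} {q} {α} {β} p∈vs q∈vs p₀≡ q₀≡) =
  ∈-++⁺ʳ (concatMap zeroRows vs)
    (∈-concatMap⁺ (pairRows vs) (lose p∈vs (∈-concatMap⁺ _ (lose q∈vs w∈pairRow))))
  where
  w∈pairRow : combine α β p q ∈ pairRow (head p) (head q) p q
  w∈pairRow rewrite p₀≡ | q₀≡ = here refl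

∈-eliminate⁻ : (vs : List (Point (suc k))) {w : Point k} → w ∈ eliminate vs → Eliminated vs w
∈-eliminate⁻ vs w∈ with ∈-++⁻ (concatMap zeroRows vs) w∈
... | inj₁ w∈zeros with find (∈-concatMap⁻ zeroRows {vs} w∈zeros)
...   | v , v∈vs , w∈zeroRows with head v in v₀≡ | w∈zeroRows
...     | + zero | here refl = zero-head v∈vs v₀≡
∈-eliminate⁻ vs w∈ | inj₂ w∈pairs with find (∈-concatMap⁻ (pairRows vs) {vs} w∈pairs)
... | p , p∈vs , w∈pairRows with find (∈-concatMap⁻ (λ q → pairRow (head p) (head q) p q) {vs} w∈pairRows)
...   | q , q∈vs , w∈pairRow with head p in p₀≡ | head q in q₀≡ | w∈pairRow
...     | +[1+ α ] | -[1+ β ] | here refl = opposite-heads p∈vs q∈vs p₀≡ q₀≡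

lifts-eliminated : {vs : List (Point (suc k))} {w : Point k} → Eliminated vs w → Lifts tail vs w
lifts-eliminated (zero-head {v} v∈vs v₀≡0) = (0 , v) ∷ [] , nonEmpty , v∈vs ∷ [] , λ z → begin
  + 1 * dot v z + 0ℤ                     ≡⟨ ℤ.+-identityʳ _ ⟩
  + 1 * dot v z                          ≡⟨ ℤ.*-identityˡ _ ⟩
  head v * head z + dot (tail v) (tail z) ≡⟨ cong (λ a → a * head z + dot (tail v) (tail z)) v₀≡0 ⟩
  0ℤ * head z + dot (tail v) (tail z)     ≡⟨ cong (_+ dot (tail v) (tail z)) (ℤ.*-zeroˡ (head z)) ⟩
  0ℤ + dot (tail v) (tail z)              ≡⟨ ℤ.+-identityˡ _ ⟩
  dot (tail v) (tail z)                   ∎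
  where open ≡-Reasoning
lifts-eliminated (opposite-heads {p} {q} {α} {β} p∈vs q∈vs p₀≡ q₀≡) =
  (β , p) ∷ (α , q) ∷ [] , nonEmpty , p∈vs ∷ q∈vs ∷ [] , λ z → begin
  + suc β * (head p * head z + P z) + (+ suc α * (head q * head z + Q z) + 0ℤ)
    ≡⟨ cong₂ (λ a b → + suc β * (a * head z + P z) + (+ suc α * (b * head z + Q z) + 0ℤ)) p₀≡ q₀≡ ⟩
  + suc β * (+[1+ α ] * head z + P z) + (+ suc α * (-[1+ β ] * head z + Q z) + 0ℤ)
    ≡⟨ cancel (+ suc α) (+ suc β) (head z) (P z) (Q z) ⟩
  + suc β * P z + + suc α * Q z
    ≡⟨ sym (dot-linearˡ (+ suc β) (+ suc α) (tail p) (tail q) (tail z)) ⟩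
  dot (combine α β p q) (tail z) ∎
  where
  open ≡-Reasoning
  P Q : Point _ → ℤ
  P z = dot (tail p) (tail z)
  Q z = dot (tail q) (tail z)
  cancel : ∀ a b x P Q → b * (a * x + P) + (a * ((- b) * x + Q) + 0ℤ) ≡ b * P + a * Q
  cancel = solve-∀

threshold : ℕ → ℤ → ℤ
threshold α y = ℤ.suc ((- y) /ℕ suc α)

threshold-sound : ∀ α y → 0ℤ < + suc α * threshold α y + y
threshold-sound α y = begin-strict
  0ℤ                                 ≡⟨ sym (ℤ.+-inverseˡ y) ⟩
  - y + y                            <⟨ ℤ.+-monoˡ-< y (n<s[n/ℕd]*d (- y) (suc α)) ⟩
  threshold α y * + suc α + y        ≡⟨ cong (_+ y) (ℤ.*-comm (threshold α y) (+ suc α)) ⟩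
  + suc α * threshold α y + y        ∎
  where open ℤ.≤-Reasoning

threshold-tight : ∀ α y → + suc α * threshold α y ≤ + suc α - y
threshold-tight α y = begin
  + suc α * threshold α y                 ≡⟨ ℤ.*-suc (+ suc α) ((- y) /ℕ suc α) ⟩
  + suc α + + suc α * ((- y) /ℕ suc α)    ≡⟨ cong (_+_ (+ suc α)) (ℤ.*-comm (+ suc α) ((- y) /ℕ suc α)) ⟩
  + suc α + (- y) /ℕ suc α * + suc α      ≤⟨ ℤ.+-monoʳ-≤ (+ suc α) ([n/ℕd]*d≤n (- y) (suc α)) ⟩
  + suc α - y                             ∎
  where open ℤ.≤-Reasoning

threshold-opposite : ∀ α β K xp xq → + suc α * + suc β < + K → 0ℤ < + suc β * xp + + suc α * xq →
                     0ℤ < -[1+ β ] * threshold α (+ K * xp) + + K * xq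
threshold-opposite α β K xp xq ab<K 0<s = begin-strict
  0ℤ                     ≡⟨ sym (ℤ.+-inverseˡ (b * t)) ⟩
  - (b * t) + b * t      <⟨ ℤ.+-monoʳ-< (- (b * t)) bt<Kxq ⟩
  - (b * t) + + K * xq   ≡⟨ cong (_+ + K * xq) (ℤ.neg-distribˡ-* b t) ⟩
  -[1+ β ] * t + + K * xq ∎
  where
  open ℤ.≤-Reasoning
  a b t : ℤ
  a = + suc α
  b = + suc β
  t = threshold α (+ K * xp)
  shuffle₁ : ∀ a b t → a * (b * t) ≡ b * (a * t)
  shuffle₁ = solve-∀
  shuffle₂ : ∀ a b c → b * (a - c) ≡ a * b - b * c
  shuffle₂ = solve-∀
  shuffle₃ : ∀ a b K xp xq → K * (b * xp + a * xq) - b * (K * xp) ≡ a * (K * xq)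
  shuffle₃ = solve-∀
  K≤Ks : + K ≤ + K * (b * xp + a * xq)
  K≤Ks = begin
    + K                       ≡⟨ sym (ℤ.*-identityʳ (+ K)) ⟩
    + K * 1ℤ                  ≤⟨ ℤ.*-monoˡ-≤-nonNeg (+ K) (ℤ.i<j⇒suc[i]≤j 0<s) ⟩
    + K * (b * xp + a * xq)   ∎
  abt<aKxq : a * (b * t) < a * (+ K * xq)
  abt<aKxq = begin-strict
    a * (b * t)                                ≡⟨ shuffle₁ a b t ⟩
    b * (a * t)                                ≤⟨ ℤ.*-monoˡ-≤-nonNeg b (threshold-tight α (+ K * xp)) ⟩
    b * (a - + K * xp)                         ≡⟨ shuffle₂ a b (+ K * xp) ⟩
    a * b - b * (+ K * xp)                     <⟨ ℤ.+-monoˡ-< (- (b * (+ K * xp))) ab<K ⟩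
    + K - b * (+ K * xp)                       ≤⟨ ℤ.+-monoˡ-≤ (- (b * (+ K * xp))) K≤Ks ⟩
    + K * (b * xp + a * xq) - b * (+ K * xp)   ≡⟨ shuffle₃ a b (+ K) xp xq ⟩
    a * (+ K * xq)                             ∎
  bt<Kxq : b * t < + K * xq
  bt<Kxq = ℤ.*-cancelˡ-<-nonNeg a abt<aKxq

lowest-threshold-sound : ∀ β B y → ∣ y ∣ ℕ.≤ B → 0ℤ < -[1+ β ] * -[1+ B ] + y
lowest-threshold-sound β B y ∣y∣≤B = begin-strict
  0ℤ                            ≡⟨ sym (ℤ.+-inverseʳ (+ suc B)) ⟩
  + suc B + -[1+ B ]            <⟨ ℤ.+-monoʳ-< (+ suc B) (ℤ.≤-<-trans (ℤ.-≤- ∣y∣≤B) (-[1+∣i∣]<i y)) ⟩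
  + suc B + y                   ≤⟨ ℤ.+-monoˡ-≤ y (+≤+ (ℕ.m≤n*m (suc B) (suc β))) ⟩
  -[1+ β ] * -[1+ B ] + y       ∎
  where
  open ℤ.≤-Reasoning
  -[1+∣i∣]<i : ∀ i → -[1+ ∣ i ∣ ] < i
  -[1+∣i∣]<i (+ n)    = ℤ.-<+
  -[1+∣i∣]<i -[1+ n ] = ℤ.-<- (ℕ.n<1+n n)

-- A row v with head a needs a t + K (tail v · d′) > 0, so rows with a > 0
-- bound t from below and rows with a < 0 from above. Each such pair of bounds is compatible
-- over ℚ, since the eliminated row (1 + β) p + (1 + α) q is positive on d′; choosing
-- K > (1 + α)(1 + β) for all heads widens each gap beyond 1, so the largest integer lower
-- bound (or -[1+ B ], which lies below every upper bound, if there is none) fits under all.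
module LiftDirection {k} (vs : List (Point (suc k))) (d′ : Point k)
                     (d′-positive : ∀ {w} → w ∈ eliminate vs → 0ℤ < dot w d′) where

  x : Point (suc k) → ℤ
  x v = dot (tail v) d′

  A : ℕ
  A = sum (map (∣_∣ ∘ head) vs)

  K : ℕ
  K = suc (A ℕ.* A)

  B : ℕ
  B = sum (map (λ v → ∣ + K * x v ∣) vs)

  thresholds : ℤ → ℤ → List ℤ
  thresholds +[1+ α ] y = threshold α y ∷ []
  thresholds _        _ = []

  rowThresholds : Point (suc k) → List ℤ
  rowThresholds v = thresholds (head v) (+ K * x v)

  t : ℤ
  t = Extrema.max -[1+ B ] (concatMap rowThresholds vs)

  d : Point (suc k)
  d = t ∷ᶠ λ i → + K * d′ i

  dot-d : ∀ v → dot v d ≡ head v * t + + K * x v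
  dot-d v = cong (_+_ (head v * t)) (dot-*ʳ (tail v) d′ (+ K))

  threshold≤t : ∀ {v α} → v ∈ vs → head v ≡ +[1+ α ] → threshold α (+ K * x v) ≤ t
  threshold≤t {v} {α} v∈vs v₀≡ =
    All.lookup (Extrema.xs≤max -[1+ B ] (concatMap rowThresholds vs))
      (∈-concatMap⁺ rowThresholds (lose v∈vs threshold∈))
    where
    threshold∈ : threshold α (+ K * x v) ∈ rowThresholds v
    threshold∈ rewrite v₀≡ = here refl

  t-cases : t ≡ -[1+ B ] ⊎
            ∃ λ p → ∃ λ α → p ∈ vs × head p ≡ +[1+ α ] × t ≡ threshold α (+ K * x p)
  t-cases with Extrema.argmax-sel id -[1+ B ] (concatMap rowThresholds vs)
  ... | inj₁ t≡ = inj₁ t≡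
  ... | inj₂ t∈ with find (∈-concatMap⁻ rowThresholds {vs} t∈)
  ...   | p , p∈vs , t∈p with head p in p₀≡ | t∈p
  ...     | +[1+ α ] | here t≡ = inj₂ (p , α , p∈vs , p₀≡ , t≡)

  head≤A : ∀ {v} → v ∈ vs → ∣ head v ∣ ℕ.≤ A
  head≤A = ≤-sum-map (∣_∣ ∘ head)

  heads<K : ∀ {p q α β} → p ∈ vs → q ∈ vs → head p ≡ +[1+ α ] → head q ≡ -[1+ β ] →
            + suc α * + suc β < + K
  heads<K p∈vs q∈vs p₀≡ q₀≡ = +<+ (s≤s (ℕ.*-mono-≤
    (subst (ℕ._≤ A) (cong ∣_∣ p₀≡) (head≤A p∈vs)) (subst (ℕ._≤ A) (cong ∣_∣ q₀≡) (head≤A q∈vs))))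

  positive : ∀ {v} → v ∈ vs → 0ℤ < dot v d
  positive {v} v∈vs rewrite dot-d v with head v in v₀≡
  ... | + zero = begin-strict
    0ℤ              ≡⟨ sym (ℤ.*-zeroʳ (+ K)) ⟩
    + K * 0ℤ        <⟨ ℤ.*-monoˡ-<-pos (+ K) (d′-positive (∈-eliminate⁺ (zero-head v∈vs v₀≡))) ⟩
    + K * x v       ≡⟨ sym (ℤ.+-identityˡ _) ⟩
    0ℤ * t + + K * x v ∎
    where open ℤ.≤-Reasoning
  ... | +[1+ α ] = begin-strict
    0ℤ
      <⟨ threshold-sound α (+ K * x v) ⟩
    +[1+ α ] * threshold α (+ K * x v) + + K * x v
      ≤⟨ ℤ.+-monoˡ-≤ (+ K * x v) (ℤ.*-monoˡ-≤-nonNeg +[1+ α ] (threshold≤t v∈vs v₀≡)) ⟩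
    +[1+ α ] * t + + K * x v
      ∎
    where open ℤ.≤-Reasoning
  ... | -[1+ β ] with t-cases
  ...   | inj₁ t≡ rewrite t≡ =
    lowest-threshold-sound β B (+ K * x v) (≤-sum-map (λ v → ∣ + K * x v ∣) v∈vs)
  ...   | inj₂ (p , α , p∈vs , p₀≡ , t≡) rewrite t≡ =
    threshold-opposite α β K (x p) (x v) (heads<K p∈vs v∈vs p₀≡ v₀≡)
      (subst (0ℤ <_) (dot-linearˡ (+ suc β) (+ suc α) (tail p) (tail v) d′)
        (d′-positive (∈-eliminate⁺ (opposite-heads p∈vs v∈vs p₀≡ v₀≡))))

lift-direction : (vs : List (Point (suc k))) → PositiveDirection (eliminate vs) → PositiveDirection vs
lift-direction vs (d′ , d′-positive) = d , positive
  where open LiftDirection vs d′ d′-positive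

gordan : ∀ k (vs : List (Point k)) → PositiveDirection vs ⊎ PositiveDependence vs
gordan zero    []       = inj₁ ((λ ()) , λ ())
gordan zero    (v ∷ vs) = inj₂ ((0 , v) ∷ [] , nonEmpty , here refl ∷ [] , λ _ → refl)
gordan (suc k) vs with gordan k (eliminate vs)
... | inj₁ direction  = inj₁ (lift-direction vs direction)
... | inj₂ dependence = inj₂ (lift-dependence tail (lifts-eliminated ∘ ∈-eliminate⁻ vs) dependence)

-- Polyhedral regions

box-⊆-halfSpace : ∀ {v d : Point k} {n N T z} → 0ℤ < dot v d → ∣ n ∣ ℕ.+ norm₁ v ℕ.* N ℕ.< T →
                  InBox (λ i → + T * d i) N z → InHalfSpace (v , n) z
box-⊆-halfSpace {v = v} {d} {n} {N} {T} {z} 0<vd size<T z∈box = begin-strict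
  n                             ≤⟨ i≤+∣i∣ n ⟩
  + ∣ n ∣                       ≡⟨ add-sub (+ ∣ n ∣) (+ r) ⟩
  + ∣ n ∣ + + r - + r           ≡⟨ cong (_- + r) (ℤ.pos-+ ∣ n ∣ r) ⟨
  + (∣ n ∣ ℕ.+ r) - + r         <⟨ ℤ.+-monoˡ-< (- + r) (+<+ size<T) ⟩
  + T - + r                     ≤⟨ ℤ.+-mono-≤ T≤Tvd (dot-lowerBound N v e ∣e∣≤N) ⟩
  + T * dot v d + dot v e       ≡⟨ cong (_+ dot v e) (dot-*ʳ v d (+ T)) ⟨
  dot v c + dot v e             ≡⟨ dot-+ʳ v c e ⟨
  dot v (λ i → c i + e i)       ≡⟨ dot-congʳ v (λ i → sub-add (z i) (c i)) ⟩
  dot v z                       ∎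
  where
  open ℤ.≤-Reasoning
  r : ℕ
  r = norm₁ v ℕ.* N
  c e : Point _
  c i = + T * d i
  e i = z i - c i
  add-sub : ∀ a b → a ≡ a + b - b
  add-sub = solve-∀
  add-sub′ : ∀ a b → a + b - a ≡ b
  add-sub′ = solve-∀
  sub-add : ∀ a b → b + (a - b) ≡ a
  sub-add = solve-∀
  ∣e∣≤N : ∀ i → ∣ e i ∣ ℕ.≤ N
  ∣e∣≤N i = 0≤i≤+n⇒∣i∣≤n (ℤ.i≤j⇒0≤j-i (proj₁ (z∈box i)))
    (ℤ.≤-trans (ℤ.+-monoˡ-≤ (- c i) (proj₂ (z∈box i))) (ℤ.≤-reflexive (add-sub′ (c i) (+ N))))
  T≤Tvd : + T ≤ + T * dot v d
  T≤Tvd = subst (_≤ + T * dot v d) (ℤ.*-identityʳ (+ T)) (ℤ.*-monoˡ-≤-nonNeg (+ T) (ℤ.i<j⇒suc[i]≤j 0<vd))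

normals : List (Linear k) → List (Point k)
normals hs = map proj₁ (filter (¬? ∘ isZero? ∘ proj₁) hs)

∈-normals⁺ : {hs : List (Linear k)} {h : Linear k} → h ∈ hs → NonZeroVec (proj₁ h) → proj₁ h ∈ normals hs
∈-normals⁺ h∈hs v≢0 = ∈-map⁺ proj₁ (∈-filter⁺ (¬? ∘ isZero? ∘ proj₁) h∈hs v≢0)

∈-normals⁻ : (hs : List (Linear k)) {v : Point k} → v ∈ normals hs → ∃ λ n → (v , n) ∈ hs × NonZeroVec v
∈-normals⁻ hs v∈ with ∈-map⁻ proj₁ v∈
... | (v , n) , h∈filter , refl = n , ∈-filter⁻ (¬? ∘ isZero? ∘ proj₁) {xs = hs} h∈filter

halfSpaces-contain-boxes : (hs : List (Linear k)) → PositiveDirection (normals hs) →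
  (∀ {h} → h ∈ hs → IsZero (proj₁ h) → proj₂ h < 0ℤ) →
  ∀ N → ∃ λ c → ∀ z → InBox c N z → All (λ h → InHalfSpace h z) hs
halfSpaces-contain-boxes hs (d , d-positive) trivial N =
  (λ i → + T * d i) , λ z z∈box → All.tabulate (λ h∈hs → inHalfSpace z z∈box h∈hs)
  where
  size : Linear _ → ℕ
  size (v , n) = ∣ n ∣ ℕ.+ norm₁ v ℕ.* N
  T : ℕ
  T = suc (sum (map size hs))
  inHalfSpace : ∀ z → InBox (λ i → + T * d i) N z → ∀ {h} → h ∈ hs → InHalfSpace h z
  inHalfSpace z z∈box {v , n} h∈hs with isZero? v
  ... | yes v≡0 = subst (n <_) (sym (dot-zeroˡ v z v≡0)) (trivial h∈hs v≡0)
  ... | no v≢0  = box-⊆-halfSpace (d-positive (∈-normals⁺ h∈hs v≢0)) (s≤s (≤-sum-map size h∈hs)) z∈box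

hyperplanes : Point k → ℤ → ℕ → List (Linear k)
hyperplanes v a zero    = (v , a) ∷ []
hyperplanes v a (suc n) = (v , a) ∷ hyperplanes v (ℤ.suc a) n

hyperplanes-nonZero : ∀ {v : Point k} a n → NonZeroVec v → All (NonZeroVec ∘ proj₁) (hyperplanes v a n)
hyperplanes-nonZero a zero    v≢0 = v≢0 ∷ []
hyperplanes-nonZero a (suc n) v≢0 = v≢0 ∷ hyperplanes-nonZero (ℤ.suc a) n v≢0

∈-hyperplanes : ∀ (v z : Point k) a n → a ≤ dot v z → dot v z ≤ a + + n →
                Any (λ h → InHyperplane h z) (hyperplanes v a n)
∈-hyperplanes v z a zero a≤x x≤a+0 = here (ℤ.≤-antisym (subst (dot v z ≤_) (ℤ.+-identityʳ a) x≤a+0) a≤x)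
∈-hyperplanes v z a (suc n) a≤x x≤a+n with dot v z ℤ.≟ a
... | yes x≡a = here x≡a
... | no  x≢a = there (∈-hyperplanes v z (ℤ.suc a) n
  (ℤ.i<j⇒suc[i]≤j (ℤ.≤∧≢⇒< a≤x (x≢a ∘ sym)))
  (subst (dot v z ≤_) (trans (cong (_+_ a) (ℤ.pos-+ 1 n)) (shift a (+ n))) x≤a+n))
  where
  shift : ∀ a n → a + (1ℤ + n) ≡ (1ℤ + a) + n
  shift = solve-∀

slab-measureZero : {R : Region k} {v : Point k} → NonZeroVec v → (M : ℕ) →
                   (∀ z → R z → - + M ≤ dot v z × dot v z ≤ + M) → MeasureZero R
slab-measureZero {v = v} v≢0 M inSlab =
  hyperplanes v (- + M) (M ℕ.+ M) , hyperplanes-nonZero (- + M) (M ℕ.+ M) v≢0 ,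
  λ z Rz → ∈-hyperplanes v z (- + M) (M ℕ.+ M) (proj₁ (inSlab z Rz))
             (subst (dot v z ≤_) width (proj₂ (inSlab z Rz)))
  where
  width : + M ≡ - + M + + (M ℕ.+ M)
  width = trans (cancel (+ M)) (cong (_+_ (- + M)) (sym (ℤ.pos-+ M M)))
    where
    cancel : ∀ m → m ≡ - m + (m + m)
    cancel = solve-∀

measureZero-of-dependence : {R : Region k} (hs : List (Linear k)) →
  (∀ z → R z → All (λ h → InHalfSpace h z) hs) → PositiveDependence (normals hs) → MeasureZero R
measureZero-of-dependence {R = R} hs R⊆hs ((c , v) ∷ ts , nonEmpty , v∈normals ∷ ts⊆normals , ⟦⟧≡0) =
  slab-measureZero (proj₂ (proj₂ (∈-normals⁻ hs v∈normals))) (N ℕ.+ L) λ z Rz →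
    ℤ.≤-trans (ℤ.neg-mono-≤ (+≤+ (ℕ.m≤m+n N L))) (normal-lowerBound z Rz v∈normals) ,
    ℤ.≤-trans (upperBound z Rz) (+≤+ (ℕ.m≤n+m L N))
  where
  N : ℕ
  N = sum (map (∣_∣ ∘ proj₂) hs)
  L : ℕ
  L = weight ts ℕ.* N
  normal-lowerBound : ∀ z → R z → ∀ {w} → w ∈ normals hs → - + N ≤ dot w z
  normal-lowerBound z Rz w∈normals with ∈-normals⁻ hs w∈normals
  ... | n , h∈hs , _ = ℤ.≤-trans (ℤ.neg-mono-≤ (+≤+ (≤-sum-map (∣_∣ ∘ proj₂) h∈hs)))
                         (ℤ.≤-trans (-+∣i∣≤i n) (ℤ.<⇒≤ (All.lookup (R⊆hs z Rz) h∈hs)))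
  upperBound : ∀ z → R z → dot v z ≤ + L
  upperBound z Rz = [1+c]*i≤+n⇒i≤+n c (dot v z) L (begin
    + suc c * dot v z                         ≡⟨ add-sub (+ suc c * dot v z) (⟦ ts ⟧ z) ⟩
    + suc c * dot v z + ⟦ ts ⟧ z - ⟦ ts ⟧ z   ≡⟨ cong (_- ⟦ ts ⟧ z) (⟦⟧≡0 z) ⟩
    0ℤ - ⟦ ts ⟧ z                             ≤⟨ ℤ.+-monoʳ-≤ 0ℤ (ℤ.neg-mono-≤ ⟦ts⟧-lowerBound) ⟩
    0ℤ - - + L                                ≡⟨ ℤ.+-identityˡ _ ⟩
    - - + L                                   ≡⟨ ℤ.neg-involutive (+ L) ⟩
    + L                                       ∎)
    where
    open ℤ.≤-Reasoning
    ⟦ts⟧-lowerBound : - + L ≤ ⟦ ts ⟧ z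
    ⟦ts⟧-lowerBound = ⟦⟧-lowerBound N (normal-lowerBound z Rz) ts ts⊆normals
    add-sub : ∀ a b → a ≡ a + b - b
    add-sub = solve-∀

zeroNormal-empty : (h : Linear k) {z : Point k} → IsZero (proj₁ h) → 0ℤ ≤ proj₂ h → ¬ InHalfSpace h z
zeroNormal-empty (v , n) {z} v≡0 0≤n n<vz = ℤ.<⇒≱ (subst (n <_) (dot-zeroˡ v z v≡0) n<vz) 0≤n

lemmaB21 : (k : ℕ) (R : Region k) → Polyhedral R →
           ((n : ℕ) → ContainsBox R (suc n)) ⊎ MeasureZero R
lemmaB21 k R (inj₁ R-everything) = inj₁ λ n → (λ _ → 0ℤ) , λ z _ → R-everything z
lemmaB21 k R (inj₂ (hs , R⇔hs))
  with Any.any? (λ h → isZero? (proj₁ h) ×-dec (0ℤ ℤ.≤? proj₂ h)) hs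
... | yes empty-halfSpace = inj₂ ([] , [] , λ z Rz → ⊥-elim (R-empty z Rz))
  where
  R-empty : ∀ z → ¬ R z
  R-empty z Rz with All.lookupAny (Equivalence.to (R⇔hs z) Rz) empty-halfSpace
  ... | z∈h , v≡0 , 0≤n = zeroNormal-empty (Any.lookup empty-halfSpace) v≡0 0≤n z∈h
... | no no-empty-halfSpace with gordan k (normals hs)
...   | inj₁ direction = inj₁ λ n →
  let c , box⊆hs = halfSpaces-contain-boxes hs direction trivial (suc n)
  in c , λ z z∈box → Equivalence.from (R⇔hs z) (box⊆hs z z∈box)
  where
  trivial : ∀ {h} → h ∈ hs → IsZero (proj₁ h) → proj₂ h < 0ℤ
  trivial h∈hs v≡0 = ℤ.≰⇒> λ 0≤n → no-empty-halfSpace (Any.map (λ { refl → v≡0 , 0≤n }) h∈hs)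
...   | inj₂ dependence =
  inj₂ (measureZero-of-dependence hs (λ z → Equivalence.to (R⇔hs z)) dependence)
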